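{- Let $c\in\mathbb{L}$ and let $A\subseteq\mathbb{L}\setminus\{c\}$ be $c$-universal. Then for every finite $X\subseteq\mathbb{L}$ there exists $\alpha\in\mathrm{Aut}(\mathbb{L};C,\prec)$ such that $\alpha(X)\subseteq A$ and $\alpha(X)|c$.
   Context: A finite rooted binary tree is a finite rooted tree in which every non-leaf vertex has exactly two children; its leaf structure is the structure on its set of leaves with the ternary relation $C$ where $C(x;yz)$ holds iff the youngest common ancestor of $y$ and $z$ is a proper descendant of the youngest common ancestor of $x,y,z$ (so $C(x;yy)$ holds whenever $x\neq y$). $(\mathbb{L};C)$ denotes the unique (up to isomorphism) countable homogeneous structure whose finite substructures are, up to isomorphism, exactly the leaf structures of finite rooted binary trees. We write $xy|z$ for $C(z;xy)$, and for a set $Y$, $Y|c$ means $yy'|c$ for all $y,y'\in Y$. $\prec$ is a fixed linear order on $\mathbb{L}$ that is convex (whenever $xy|z$, $z$ does not lie strictly between $x$ and $y$) and such that $(\mathbb{L};C,\prec)$ is homogeneous. A set $A\subseteq\mathbb{L}\setminus\{c\}$ is $c$-universal if for every finite $U\subset\mathbb{L}$ and $u\in U$ there is $\alpha\in\mathrm{Aut}(\mathbb{L};C)$ with $\alpha(u)=c$ and $\alpha(U)\subseteq A\cup\{c\}$. -}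

module Defs where

open import Data.Nat using (ℕ; suc)
open import Data.Fin using (Fin)
open import Data.Product using (Σ; _×_; _,_)
open import Data.Sum using (_⊎_)
open import Relation.Binary.PropositionalEquality using (_≡_; _≢_)
open import Relation.Nullary using (¬_)
open import Relation.Binary using (IsStrictTotalOrder)
open import Function using (Injective; _⇔_)

data BTree : Set where
  leaf : BTree
  node : BTree → BTree → BTree

data Leaf : BTree → Set where
  here  : Leaf leaf
  left  : ∀ {l r} → Leaf l → Leaf (node l r)
  right : ∀ {l r} → Leaf r → Leaf (node l r)

-- LeafC t x y z  means  C(x;yz): the youngest common ancestor of y and z is a
-- proper descendant of the youngest common ancestor of x, y, z.
-- (Computed by recursion: at a node, either y,z lie on one side and x on the
-- other — then yca(y,z) is strictly below the root = yca(x,y,z) — or all three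
-- lie on the same side and we recurse; if y,z are on different sides,
-- yca(y,z) is the root and the relation fails; at a single leaf it fails.)
data LeafC : {t : BTree} → Leaf t → Leaf t → Leaf t → Set where
  sepR : ∀ {l r} {x : Leaf r} {y z : Leaf l} → LeafC (right x) (left y) (left z)
  sepL : ∀ {l r} {x : Leaf l} {y z : Leaf r} → LeafC (left x) (right y) (right z)
  inL  : ∀ {l r} {x y z : Leaf l} → LeafC x y z →
           LeafC {node l r} (left x) (left y) (left z)
  inR  : ∀ {l r} {x y z : Leaf r} → LeafC x y z →
           LeafC {node l r} (right x) (right y) (right z)

-- Structures with a ternary relation C  (C x y z  reads  C(x;yz))

Ternary : Set → Set₁
Ternary L = L → L → L → Set

record Bij (A B : Set) : Set where
  field
    to       : A → B
    from     : B → A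
    to-from  : ∀ y → to (from y) ≡ y
    from-to  : ∀ x → from (to x) ≡ x
open Bij public

FinSubIsoLeaf : {L : Set} (C : Ternary L) {n : ℕ} (e : Fin (suc n) → L) (t : BTree) → Set
FinSubIsoLeaf C {n} e t =
  Σ (Bij (Fin (suc n)) (Leaf t)) λ β →
    ∀ i j k → C (e i) (e j) (e k) ⇔ LeafC (to β i) (to β j) (to β k)

record Aut (L : Set) (C : Ternary L) : Set where
  field
    bij  : Bij L L
    presC : ∀ x y z → C x y z ⇔ C (to bij x) (to bij y) (to bij z)
open Aut public

record AutO (L : Set) (C : Ternary L) (_≺_ : L → L → Set) : Set where
  field
    aut   : Aut L C
    pres≺ : ∀ x y → x ≺ y ⇔ (to (bij aut) x ≺ to (bij aut) y)
open AutO public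

autFun : {L : Set} {C : Ternary L} → Aut L C → L → L
autFun α = to (bij α)

autOFun : {L : Set} {C : Ternary L} {_≺_ : L → L → Set} → AutO L C _≺_ → L → L
autOFun α = to (bij (aut α))

-- Such a structure is unique up to isomorphism, so
-- these properties characterise (𝕃;C).
record IsLStructure (L : Set) (C : Ternary L) : Set₁ where
  field
    code        : L → ℕ
    code-inj    : Injective _≡_ _≡_ code
    age-sound   : ∀ n (e : Fin (suc n) → L) → Injective _≡_ _≡_ e →
                    Σ BTree λ t → FinSubIsoLeaf C e t
    age-complete : ∀ (t : BTree) → Σ (Leaf t → L) λ e →
                    Injective _≡_ _≡_ e ×
                    (∀ x y z → LeafC x y z ⇔ C (e x) (e y) (e z))
    homogeneous : ∀ n (a b : Fin n → L) →
                    Injective _≡_ _≡_ a → Injective _≡_ _≡_ b →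
                    (∀ i j k → C (a i) (a j) (a k) ⇔ C (b i) (b j) (b k)) →
                    Σ (Aut L C) λ α → ∀ i → autFun α (a i) ≡ b i

record IsConvexHomOrder (L : Set) (C : Ternary L) (_≺_ : L → L → Set) : Set₁ where
  field
    linear      : IsStrictTotalOrder _≡_ _≺_
    -- convex: whenever xy|z (i.e. C z x y), z is not strictly between x and y
    convex      : ∀ x y z → C z x y → ¬ (x ≺ z × z ≺ y) × ¬ (y ≺ z × z ≺ x)
    homogeneous : ∀ n (a b : Fin n → L) →
                    Injective _≡_ _≡_ a → Injective _≡_ _≡_ b →
                    (∀ i j k → C (a i) (a j) (a k) ⇔ C (b i) (b j) (b k)) →
                    (∀ i j → a i ≺ a j ⇔ b i ≺ b j) →
                    Σ (AutO L C _≺_) λ α → ∀ i → autOFun α (a i) ≡ b i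

CUniversal : (L : Set) (C : Ternary L) (c : L) (A : L → Set) → Set
CUniversal L C c A =
  ∀ n (U : Fin n → L) (i : Fin n) →
    Σ (Aut L C) λ α → (autFun α (U i) ≡ c) × (∀ j → A (autFun α (U j)) ⊎ autFun α (U j) ≡ c)

-- Realise the finite set X as the leaf structure of a binary tree t. Universality, applied to
-- the doubled tree double t with an apex leaf beside it, yields a copy of double t inside A
-- all of whose points are split from c. That copy need not respect ≺, but doubling absorbs
-- this: for any convex orders on the leaves of t and of double t, some embedding of t into
-- double t is order preserving. At a node each convex order lists one subtree entirely
-- before the other, and both halves of double (node l r) contain copies of double l and
-- double r, so l and r can be sent into opposite halves in whichever order is needed.
-- Homogeneity of (L;C,≺) then moves X onto such a copy.
module Submission where

open import Defs
open import Data.Empty using (⊥-elim)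
open import Data.Fin using (Fin; zero; suc; splitAt; _↑ˡ_; _↑ʳ_)
open import Data.Fin.Properties using (any?; splitAt-↑ˡ; splitAt-↑ʳ)
open import Data.Nat using (ℕ; zero; suc; _+_)
open import Data.Product using (Σ; _×_; _,_; proj₁; proj₂)
import Data.Product as Product
open import Data.Sum using (_⊎_; inj₁; inj₂; [_,_]; swap)
open import Data.Vec.Functional using (_∷_)
open import Function using (_∘_; id; flip)
open import Function.Bundles using (_⇔_; mk⇔; Equivalence)
open import Function.Construct.Composition using (_⇔-∘_)
open import Function.Construct.Symmetry using (⇔-sym)
open import Function.Definitions using (Injective)
open import Level using (0ℓ)
open import Relation.Binary using (Rel; IsStrictTotalOrder; tri<; tri≈; tri>; DecidableEquality)
open import Relation.Binary.Core using (_Preserves_⟶_)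
open import Relation.Binary.PropositionalEquality
  using (_≡_; _≢_; refl; sym; trans; cong; subst; subst₂)
open import Relation.Nullary using (¬_; yes; no)

Bij-injective : ∀ {A B} (β : Bij A B) → Injective _≡_ _≡_ (to β)
Bij-injective β {x} {y} eq = trans (sym (from-to β x)) (trans (cong (from β) eq) (from-to β y))

Bij-sym : ∀ {A B} → Bij A B → Bij B A
Bij-sym β = record { to = from β ; from = to β ; to-from = from-to β ; from-to = to-from β }

idAutO : ∀ {L C} {_≺_ : Rel L 0ℓ} → AutO L C _≺_
idAutO = record
  { aut   = record
    { bij   = record { to = id ; from = id ; to-from = λ _ → refl ; from-to = λ _ → refl }
    ; presC = λ _ _ _ → mk⇔ id id }
  ; pres≺ = λ _ _ → mk⇔ id id }

record IsEmbedding {A B : Set} (CA : Ternary A) (CB : Ternary B) (f : A → B) : Set where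
  field
    injective : Injective _≡_ _≡_ f
    preserves : ∀ x y z → CA x y z ⇔ CB (f x) (f y) (f z)
open IsEmbedding

IsEmbedding-∘ : ∀ {A B D} {CA : Ternary A} {CB : Ternary B} {CD : Ternary D} {f : B → D} {g : A → B} →
  IsEmbedding CB CD f → IsEmbedding CA CB g → IsEmbedding CA CD (f ∘ g)
IsEmbedding-∘ F G = record
  { injective = injective G ∘ injective F
  ; preserves = λ x y z → preserves F _ _ _ ⇔-∘ preserves G x y z }

Aut-isEmbedding : ∀ {L C} (γ : Aut L C) → IsEmbedding C C (autFun γ)
Aut-isEmbedding γ = record { injective = Bij-injective (bij γ) ; preserves = presC γ }

-- Only one of the two betweenness exclusions is required; the other is the same axiom
-- applied to C z y x.
record IsConvexOrder {A : Set} (CA : Ternary A) (R : Rel A 0ℓ) : Set where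
  field
    asym   : ∀ {x y} → R x y → ¬ R y x
    total  : ∀ {x y} → x ≢ y → R x y ⊎ R y x
    convex : ∀ {x y z} → CA z x y → R x z → ¬ R z y
open IsConvexOrder

IsConvexOrder-restrict : ∀ {A B} {CA : Ternary A} {CB : Ternary B} {f : A → B} {R : Rel B 0ℓ} →
  IsEmbedding CA CB f → IsConvexOrder CB R → IsConvexOrder CA (λ x y → R (f x) (f y))
IsConvexOrder-restrict F o = record
  { asym   = asym o
  ; total  = λ x≢y → total o (x≢y ∘ injective F)
  ; convex = λ zxy → convex o (Equivalence.to (preserves F _ _ _) zxy) }

Separated : {L I : Set} → Ternary L → L → (L → Set) → (I → L) → Set
Separated C c A Z = (∀ i → A (Z i)) × (∀ i j → C c (Z i) (Z j))

Separated-⊆ : ∀ {L I J : Set} {C : Ternary L} {c A} {X : I → L} {Z : J → L} →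
  (∀ i → Σ J λ k → X i ≡ Z k) → Separated C c A Z → Separated C c A X
Separated-⊆ {C = C} {c} {A} X⊆Z (inA , split) =
  (λ i → subst A (sym (proj₂ (X⊆Z i))) (inA _)) ,
  λ i j → subst₂ (C c) (sym (proj₂ (X⊆Z i))) (sym (proj₂ (X⊆Z j))) (split _ _)

LeafC-sym : ∀ {t} {x y z : Leaf t} → LeafC x y z → LeafC x z y
LeafC-sym sepR    = sepR
LeafC-sym sepL    = sepL
LeafC-sym (inL p) = inL (LeafC-sym p)
LeafC-sym (inR p) = inR (LeafC-sym p)

inL-⇔ : ∀ {l r} {x y z : Leaf l} → LeafC x y z ⇔ LeafC {node l r} (left x) (left y) (left z)
inL-⇔ = mk⇔ inL λ { (inL p) → p }

inR-⇔ : ∀ {l r} {x y z : Leaf r} → LeafC x y z ⇔ LeafC {node l r} (right x) (right y) (right z)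
inR-⇔ = mk⇔ inR λ { (inR p) → p }

left-isEmbedding : ∀ {l r} → IsEmbedding LeafC LeafC (left {l} {r})
left-isEmbedding = record { injective = λ { refl → refl } ; preserves = λ _ _ _ → inL-⇔ }

right-isEmbedding : ∀ {l r} → IsEmbedding LeafC LeafC (right {l} {r})
right-isEmbedding = record { injective = λ { refl → refl } ; preserves = λ _ _ _ → inR-⇔ }

nodeMap : ∀ {l r u v} → (Leaf l → Leaf u) → (Leaf r → Leaf v) → Leaf (node l r) → Leaf (node u v)
nodeMap f g (left x)  = left (f x)
nodeMap f g (right y) = right (g y)

nodeMap-isEmbedding : ∀ {l r u v} {f : Leaf l → Leaf u} {g : Leaf r → Leaf v} →
  IsEmbedding LeafC LeafC f → IsEmbedding LeafC LeafC g → IsEmbedding LeafC LeafC (nodeMap f g)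
nodeMap-isEmbedding {f = f} {g} F G = record { injective = inj ; preserves = pres }
  where
  inj : Injective _≡_ _≡_ (nodeMap f g)
  inj {left _}  {left _}  eq = cong left (injective F (injective left-isEmbedding eq))
  inj {right _} {right _} eq = cong right (injective G (injective right-isEmbedding eq))
  inj {left _}  {right _} ()
  inj {right _} {left _}  ()
  pres : ∀ x y z → LeafC x y z ⇔ LeafC (nodeMap f g x) (nodeMap f g y) (nodeMap f g z)
  pres (left x)  (left y)  (left z)  = inL-⇔ ⇔-∘ (preserves F x y z ⇔-∘ ⇔-sym inL-⇔)
  pres (right x) (right y) (right z) = inR-⇔ ⇔-∘ (preserves G x y z ⇔-∘ ⇔-sym inR-⇔)
  pres (left _)  (right _) (right _) = mk⇔ (λ _ → sepL) (λ _ → sepL)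
  pres (right _) (left _)  (left _)  = mk⇔ (λ _ → sepR) (λ _ → sepR)
  pres (left _)  (left _)  (right _) = mk⇔ (λ ()) (λ ())
  pres (left _)  (right _) (left _)  = mk⇔ (λ ()) (λ ())
  pres (right _) (left _)  (right _) = mk⇔ (λ ()) (λ ())
  pres (right _) (right _) (left _)  = mk⇔ (λ ()) (λ ())

swapHalves : ∀ {u} → Leaf (node u u) → Leaf (node u u)
swapHalves (left x)  = right x
swapHalves (right x) = left x

swapHalves-isEmbedding : ∀ {u} → IsEmbedding LeafC LeafC (swapHalves {u})
swapHalves-isEmbedding = record { injective = inj ; preserves = pres }
  where
  inj : Injective _≡_ _≡_ swapHalves
  inj {left _}  {left _}  refl = refl
  inj {right _} {right _} refl = refl
  inj {left _}  {right _} ()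
  inj {right _} {left _}  ()
  pres : ∀ x y z → LeafC x y z ⇔ LeafC (swapHalves x) (swapHalves y) (swapHalves z)
  pres (left _)  (left _)  (left _)  = inR-⇔ ⇔-∘ ⇔-sym inL-⇔
  pres (right _) (right _) (right _) = inL-⇔ ⇔-∘ ⇔-sym inR-⇔
  pres (left _)  (right _) (right _) = mk⇔ (λ _ → sepR) (λ _ → sepL)
  pres (right _) (left _)  (left _)  = mk⇔ (λ _ → sepL) (λ _ → sepR)
  pres (left _)  (left _)  (right _) = mk⇔ (λ ()) (λ ())
  pres (left _)  (right _) (left _)  = mk⇔ (λ ()) (λ ())
  pres (right _) (left _)  (right _) = mk⇔ (λ ()) (λ ())
  pres (right _) (right _) (left _)  = mk⇔ (λ ()) (λ ())

IsConvexOrder-flip : ∀ {t} {R : Rel (Leaf t) 0ℓ} → IsConvexOrder LeafC R → IsConvexOrder LeafC (flip R)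
IsConvexOrder-flip o = record
  { asym   = asym o
  ; total  = swap ∘ total o
  ; convex = λ zxy z<x y<z → convex o (LeafC-sym zxy) y<z z<x }

someLeaf : ∀ t → Leaf t
someLeaf leaf       = here
someLeaf (node l _) = left (someLeaf l)

LeftFirst : ∀ {l r} → Rel (Leaf (node l r)) 0ℓ → Set
LeftFirst R = ∀ x y → R (left x) (right y)

leftFirst-from : ∀ {l r} {R : Rel (Leaf (node l r)) 0ℓ} {x₀ y₀} →
  IsConvexOrder LeafC R → R (left x₀) (right y₀) → LeftFirst R
leftFirst-from {R = R} o x₀<y₀ x y = orient λ y<x → convex o sepL y<x (orient λ y₀<x → convex o sepR x₀<y₀ y₀<x)
  where
  orient : ∀ {x y} → ¬ R (right y) (left x) → R (left x) (right y)
  orient ¬y<x = [ id , ⊥-elim ∘ ¬y<x ] (total o λ ())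

leftFirst⊎rightFirst : ∀ {l r} {R : Rel (Leaf (node l r)) 0ℓ} →
  IsConvexOrder LeafC R → LeftFirst R ⊎ LeftFirst (flip R)
leftFirst⊎rightFirst {l} {r} o with total o {left (someLeaf l)} {right (someLeaf r)} (λ ())
... | inj₁ x₀<y₀ = inj₁ (leftFirst-from o x₀<y₀)
... | inj₂ y₀<x₀ = inj₂ (leftFirst-from (IsConvexOrder-flip o) y₀<x₀)

double : BTree → BTree
double leaf       = leaf
double (node l r) = node (node (double l) (double r)) (node (double l) (double r))

OrdersEmbedInDouble : BTree → Set₁
OrdersEmbedInDouble t =
  ∀ {R : Rel (Leaf t) 0ℓ} {S : Rel (Leaf (double t)) 0ℓ} → IsConvexOrder LeafC R → IsConvexOrder LeafC S →
  Σ (Leaf t → Leaf (double t)) λ s → IsEmbedding LeafC LeafC s × s Preserves R ⟶ S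

ordersEmbedInDouble-leftFirst : ∀ {l r} → OrdersEmbedInDouble l → OrdersEmbedInDouble r →
  ∀ {R S} → IsConvexOrder LeafC R → IsConvexOrder LeafC S → LeftFirst R → LeftFirst S →
  Σ (Leaf (node l r) → Leaf (double (node l r))) λ s → IsEmbedding LeafC LeafC s × s Preserves R ⟶ S
ordersEmbedInDouble-leftFirst {l} {r} ih-l ih-r {R} {S} oR oS R-lr S-lr
  with ih-l (IsConvexOrder-restrict left-isEmbedding oR)
            (IsConvexOrder-restrict (IsEmbedding-∘ left-isEmbedding left-isEmbedding) oS)
     | ih-r (IsConvexOrder-restrict right-isEmbedding oR)
            (IsConvexOrder-restrict (IsEmbedding-∘ right-isEmbedding right-isEmbedding) oS)
... | sl , sl-emb , sl-mono | sr , sr-emb , sr-mono =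
  s , nodeMap-isEmbedding (IsEmbedding-∘ left-isEmbedding sl-emb) (IsEmbedding-∘ right-isEmbedding sr-emb) , mono
  where
  s : Leaf (node l r) → Leaf (double (node l r))
  s = nodeMap (left ∘ sl) (right ∘ sr)
  mono : s Preserves R ⟶ S
  mono {left _}  {left _}        = sl-mono
  mono {right _} {right _}       = sr-mono
  mono {left _}  {right _}   _   = S-lr _ _
  mono {right x} {left y}    y<x = ⊥-elim (asym oR (R-lr y x) y<x)

-- If S lists the right half first, l is sent into the right half and r into the left one.
ordersEmbedInDouble-leftFirstR : ∀ {l r} → OrdersEmbedInDouble l → OrdersEmbedInDouble r →
  ∀ {R S} → IsConvexOrder LeafC R → IsConvexOrder LeafC S → LeftFirst R →
  Σ (Leaf (node l r) → Leaf (double (node l r))) λ s → IsEmbedding LeafC LeafC s × s Preserves R ⟶ S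
ordersEmbedInDouble-leftFirstR ih-l ih-r oR oS R-lr with leftFirst⊎rightFirst oS
... | inj₁ S-lr = ordersEmbedInDouble-leftFirst ih-l ih-r oR oS R-lr S-lr
... | inj₂ S-rl
  with ordersEmbedInDouble-leftFirst ih-l ih-r oR (IsConvexOrder-restrict swapHalves-isEmbedding oS)
                                     R-lr (flip S-rl)
...   | s , s-emb , s-mono = swapHalves ∘ s , IsEmbedding-∘ swapHalves-isEmbedding s-emb , s-mono

ordersEmbedInDouble-node : ∀ {l r} → OrdersEmbedInDouble l → OrdersEmbedInDouble r →
  OrdersEmbedInDouble (node l r)
ordersEmbedInDouble-node ih-l ih-r oR oS with leftFirst⊎rightFirst oR
... | inj₁ R-lr = ordersEmbedInDouble-leftFirstR ih-l ih-r oR oS R-lr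
... | inj₂ R-rl
  with ordersEmbedInDouble-leftFirstR ih-l ih-r (IsConvexOrder-flip oR) (IsConvexOrder-flip oS) R-rl
...   | s , s-emb , s-mono = s , s-emb , λ {x} {y} → s-mono {y} {x}

ordersEmbedInDouble : ∀ t → OrdersEmbedInDouble t
ordersEmbedInDouble leaf oR _ =
  id , record { injective = id ; preserves = λ _ _ _ → mk⇔ id id } ,
  λ { {here} {here} r → ⊥-elim (asym oR r r) }
ordersEmbedInDouble (node l r) = ordersEmbedInDouble-node (ordersEmbedInDouble l) (ordersEmbedInDouble r)

size : BTree → ℕ
size leaf       = 1
size (node l r) = size l + size r

enumerate : ∀ t → Fin (size t) → Leaf t
enumerate leaf       _ = here
enumerate (node l r)   = [ left ∘ enumerate l , right ∘ enumerate r ] ∘ splitAt (size l)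

position : ∀ t → Leaf t → Fin (size t)
position leaf       here      = zero
position (node l r) (left x)  = position l x ↑ˡ size r
position (node l r) (right y) = size l ↑ʳ position r y

enumerate-position : ∀ t p → enumerate t (position t p) ≡ p
enumerate-position leaf here = refl
enumerate-position (node l r) (left x)
  rewrite splitAt-↑ˡ (size l) (position l x) (size r) = cong left (enumerate-position l x)
enumerate-position (node l r) (right y)
  rewrite splitAt-↑ʳ (size l) (size r) (position r y) = cong right (enumerate-position r y)

deduplicate : {A : Set} → DecidableEquality A → ∀ {n} (X : Fin n → A) →
  Σ ℕ λ m → Σ (Fin m → A) λ Y → Injective _≡_ _≡_ Y × (∀ i → Σ (Fin m) λ k → X i ≡ Y k)
deduplicate _≟_ {zero} X = zero , (λ ()) , (λ { {()} }) , λ ()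
deduplicate _≟_ {suc n} X with deduplicate _≟_ (X ∘ suc)
... | m , Y , Y-inj , X⊆Y with any? (λ k → X zero ≟ Y k)
...   | yes (k , X₀≡Yk) = m , Y , Y-inj , λ { zero → k , X₀≡Yk ; (suc i) → X⊆Y i }
...   | no X₀∉Y = suc m , X zero ∷ Y , inj , λ { zero → zero , refl ; (suc i) → Product.map suc id (X⊆Y i) }
  where
  inj : Injective _≡_ _≡_ (X zero ∷ Y)
  inj {zero}  {zero}  _  = refl
  inj {zero}  {suc j} eq = ⊥-elim (X₀∉Y (j , eq))
  inj {suc i} {zero}  eq = ⊥-elim (X₀∉Y (i , sym eq))
  inj {suc i} {suc j} eq = cong suc (Y-inj eq)

FinSubIsoLeaf⇒IsEmbedding : ∀ {L} {C : Ternary L} {n} {e : Fin (suc n) → L} {t} →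
  Injective _≡_ _≡_ e → ((β , _) : FinSubIsoLeaf C e t) → IsEmbedding LeafC C (e ∘ from β)
FinSubIsoLeaf⇒IsEmbedding e-inj (β , e≅t) = record
  { injective = Bij-injective (Bij-sym β) ∘ e-inj
  ; preserves = λ x y z →
      retarget (to-from β x) (to-from β y) (to-from β z) (⇔-sym (e≅t (from β x) (from β y) (from β z))) }
  where
  retarget : ∀ {x′ y′ z′ x y z} {P : Set} → x′ ≡ x → y′ ≡ y → z′ ≡ z →
    LeafC x′ y′ z′ ⇔ P → LeafC x y z ⇔ P
  retarget refl refl refl h = h

module _ {L : Set} {C : Ternary L} where

  module _ {_≺_ : Rel L 0ℓ} (isO : IsConvexHomOrder L C _≺_) where
    open IsConvexHomOrder isO using (linear; homogeneous)
    open IsStrictTotalOrder linear using (compare; irrefl) renaming (asym to ≺-asym)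

    ≺-isConvexOrder : IsConvexOrder C _≺_
    ≺-isConvexOrder = record
      { asym   = ≺-asym
      ; total  = total≺
      ; convex = λ zxy x≺z z≺y → proj₁ (IsConvexHomOrder.convex isO _ _ _ zxy) (x≺z , z≺y) }
      where
      total≺ : ∀ {x y} → x ≢ y → x ≺ y ⊎ y ≺ x
      total≺ {x} {y} x≢y with compare x y
      ... | tri< x≺y _ _ = inj₁ x≺y
      ... | tri≈ _ x≡y _ = ⊥-elim (x≢y x≡y)
      ... | tri> _ _ y≺x = inj₂ y≺x

    monotone⇒≺-iso : ∀ {I : Set} {a b : I → L} → Injective _≡_ _≡_ a →
      (∀ {i j} → a i ≺ a j → b i ≺ b j) → ∀ i j → a i ≺ a j ⇔ b i ≺ b j
    monotone⇒≺-iso {a = a} {b} a-inj mono i j = mk⇔ mono reflect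
      where
      reflect : b i ≺ b j → a i ≺ a j
      reflect bi≺bj with compare (a i) (a j)
      ... | tri< ai≺aj _ _ = ai≺aj
      ... | tri≈ _ ai≡aj _ = ⊥-elim (irrefl (cong b (a-inj ai≡aj)) bi≺bj)
      ... | tri> _ _ aj≺ai = ⊥-elim (≺-asym (mono aj≺ai) bi≺bj)

    extend-leafCopies : ∀ {n t} → Bij (Fin n) (Leaf t) → {g h : Leaf t → L} →
      IsEmbedding LeafC C g → IsEmbedding LeafC C h → (∀ {x y} → g x ≺ g y → h x ≺ h y) →
      Σ (AutO L C _≺_) λ α → ∀ x → autOFun α (g x) ≡ h x
    extend-leafCopies {n} β {g} {h} G H mono
      with homogeneous n (g ∘ to β) (h ∘ to β) (Bij-injective β ∘ injective G) (Bij-injective β ∘ injective H)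
             (λ i j k → preserves H _ _ _ ⇔-∘ ⇔-sym (preserves G _ _ _))
             (monotone⇒≺-iso (Bij-injective β ∘ injective G) mono)
    ... | α , α-ext = α , λ x → subst (λ p → autOFun α (g p) ≡ h p) (to-from β x) (α-ext (from β x))

  module _ (isL : IsLStructure L C) (c : L) {A : L → Set} (univ : CUniversal L C c A) where

    separatedCopy : ∀ u → Σ (Leaf u → L) λ f → IsEmbedding LeafC C f × Separated C c A f
    separatedCopy u with IsLStructure.age-complete isL (node u leaf)
    ... | e , e-inj , e-pres
      with univ (size (node u leaf)) (e ∘ enumerate (node u leaf)) (position (node u leaf) (right here))
    ... | γ , apex↦c , into-A∪c = φ ∘ left , IsEmbedding-∘ φ-emb left-isEmbedding , inA , split
      where
      φ : Leaf (node u leaf) → L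
      φ = autFun γ ∘ e
      φ-emb : IsEmbedding LeafC C φ
      φ-emb = IsEmbedding-∘ (Aut-isEmbedding γ) (record { injective = e-inj ; preserves = e-pres })
      φ-at : ∀ p → φ (enumerate (node u leaf) (position (node u leaf) p)) ≡ φ p
      φ-at p = cong φ (enumerate-position (node u leaf) p)
      φ-apex : φ (right here) ≡ c
      φ-apex = trans (sym (φ-at (right here))) apex↦c
      inA : ∀ p → A (φ (left p))
      inA p with into-A∪c (position (node u leaf) (left p))
      ... | inj₁ A-at = subst A (φ-at (left p)) A-at
      ... | inj₂ at≡c with injective φ-emb (trans (sym (φ-at (left p))) (trans at≡c (sym φ-apex)))
      ...   | ()
      split : ∀ p q → C c (φ (left p)) (φ (left q))
      split p q = subst (λ w → C w (φ (left p)) (φ (left q))) φ-apex (Equivalence.to (preserves φ-emb _ _ _) sepR)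

    separate-leafCopy : ∀ {_≺_ : Rel L 0ℓ} → IsConvexHomOrder L C _≺_ → ∀ {n t} → Bij (Fin n) (Leaf t) →
      {g : Leaf t → L} → IsEmbedding LeafC C g → Σ (AutO L C _≺_) λ α → Separated C c A (autOFun α ∘ g)
    separate-leafCopy isO {t = t} β G with separatedCopy (double t)
    ... | f , F , inA , split
      with ordersEmbedInDouble t (IsConvexOrder-restrict G (≺-isConvexOrder isO))
                                 (IsConvexOrder-restrict F (≺-isConvexOrder isO))
    ... | s , S , s-mono with extend-leafCopies isO β G (IsEmbedding-∘ F S) s-mono
    ... | α , α-ext = α , Separated-⊆ {C = C} {c} {A} {Z = f} (λ x → s x , α-ext x) (inA , split)

mainTheorem18 : {L : Set} {C : Ternary L} {_≺_ : L → L → Set} →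
    IsLStructure L C → IsConvexHomOrder L C _≺_ →
    (c : L) (A : L → Set) → (∀ a → A a → a ≢ c) → CUniversal L C c A →
    ∀ n (X : Fin n → L) →
    Σ (AutO L C _≺_) λ α →
      (∀ i → A (autOFun α (X i))) × (∀ i j → C c (autOFun α (X i)) (autOFun α (X j)))
mainTheorem18 {C = C} isL isO c A _ univ n X
  with deduplicate (IsStrictTotalOrder._≟_ (IsConvexHomOrder.linear isO)) X
... | zero , _ , _ , X⊆∅ = idAutO , Separated-⊆ {C = C} {c} {A} X⊆∅ ((λ ()) , λ ())
... | suc m , Y , Y-inj , X⊆Y with IsLStructure.age-sound isL m Y Y-inj
...   | t , β , Y≅t with separate-leafCopy isL c {A} univ isO β (FinSubIsoLeaf⇒IsEmbedding Y-inj (β , Y≅t))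
...     | α , split = α , Separated-⊆ {C = C} {c} {A} αX⊆αY split
  where
  αX⊆αY : ∀ i → Σ (Leaf t) λ x → autOFun α (X i) ≡ autOFun α (Y (from β x))
  αX⊆αY i with X⊆Y i
  ... | k , Xi≡Yk = to β k , cong (autOFun α) (trans Xi≡Yk (cong Y (sym (from-to β k))))
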